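{- Let $G$ be a graph of order $n$ and size $m$ with no isolated vertices. Then $\chi_i'(G)=m$ if and only if $G$ is complete.
   Context: All graphs are finite and simple; size means number of edges. Three edges $e_1,e_2,e_3$ of a graph $G$ (in this order) are consecutive if $e_1=xy$, $e_2=yz$, $e_3=zu$ for some vertices $x,y,z,u$ (where $x=u$ is allowed). An injective edge coloring of $G$ is a map $c:E(G)\to\mathcal{C}$ such that whenever $e_1,e_2,e_3$ are consecutive edges, $c(e_1)\neq c(e_3)$. The injective edge chromatic index $\chi_i'(G)$ is the minimum number of colors in an injective edge coloring of $G$. -}

module Defs where

open import Data.Nat using (ℕ; zero; suc; _<ᵇ_; _<_)
open import Data.Bool using (Bool; true; false; T; _∧_; if_then_else_)
open import Data.Fin using (Fin; toℕ)
open import Data.List using (List; map; allFin)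
open import Data.Nat.ListAction using (sum)
open import Data.Product using (Σ; ∃; _×_; _,_; proj₁; proj₂)
open import Data.Sum using (_⊎_)
open import Relation.Binary.PropositionalEquality using (_≡_; _≢_)
open import Relation.Nullary using (¬_)

record Graph (n : ℕ) : Set where
  field
    adj    : Fin n → Fin n → Bool
    sym    : ∀ i j → adj i j ≡ adj j i
    irrefl : ∀ i → adj i i ≡ false
open Graph public

-- An edge {i,j} is represented canonically by the ordered pair (i , j) with i < j.
isEdge : ∀ {n} → Graph n → Fin n → Fin n → Bool
isEdge G i j = (toℕ i <ᵇ toℕ j) ∧ adj G i j

Edge : ∀ {n} → Graph n → Set
Edge {n} G = Σ (Fin n × Fin n) λ p → T (isEdge G (proj₁ p) (proj₂ p))

size : ∀ {n} → Graph n → ℕ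
size {n} G = sum (map (λ i → sum (map (λ j → if isEdge G i j then 1 else 0) (allFin n))) (allFin n))

Joins : ∀ {n} {G : Graph n} → Edge G → Fin n → Fin n → Set
Joins ((i , j) , _) a b = (i ≡ a × j ≡ b) ⊎ (i ≡ b × j ≡ a)

-- e₁ , e₂ , e₃ consecutive: e₁ = xy, e₂ = yz, e₃ = zu, three distinct edges
-- (x = u allowed; x ≢ z and y ≢ u so that the three edges are distinct)
Consecutive : ∀ {n} {G : Graph n} → Edge G → Edge G → Edge G → Set
Consecutive {n} {G} e₁ e₂ e₃ =
  ∃ λ (x : Fin n) → ∃ λ (y : Fin n) → ∃ λ (z : Fin n) → ∃ λ (u : Fin n) →
    Joins {G = G} e₁ x y × Joins {G = G} e₂ y z × Joins {G = G} e₃ z u × x ≢ z × y ≢ u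

IsInjEdgeColoring : ∀ {n} (G : Graph n) {k : ℕ} → (Edge G → Fin k) → Set
IsInjEdgeColoring G c = ∀ e₁ e₂ e₃ → Consecutive {G = G} e₁ e₂ e₃ → c e₁ ≢ c e₃

InjColorable : ∀ {n} → Graph n → ℕ → Set
InjColorable G k = Σ (Edge G → Fin k) (IsInjEdgeColoring G)

InjChromIndexIs : ∀ {n} → Graph n → ℕ → Set
InjChromIndexIs G k = InjColorable G k × (∀ j → j < k → ¬ InjColorable G j)

NoIsolatedVertices : ∀ {n} → Graph n → Set
NoIsolatedVertices {n} G = ∀ (v : Fin n) → ∃ λ (w : Fin n) → T (adj G v w)

Complete : ∀ {n} → Graph n → Set
Complete {n} G = ∀ (v w : Fin n) → v ≢ w → T (adj G v w)

-- Call two edges e, f *linked* if e, g, f are consecutive for some edge g.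
-- Since consecutive edges e₁, e₃ are distinct, numbering the edges 0 … m-1
-- is always an injective edge colouring, so χ'ᵢ(G) ≤ m.  Moreover
--   * if all pairs of distinct edges are linked, any two edges need
--     different colours, so by pigeonhole χ'ᵢ(G) = m;
--   * if some distinct e, f are unlinked, giving f the colour of e in the
--     numbering is still injective, so χ'ᵢ(G) < m.
-- In a complete graph every two distinct edges are linked.  Conversely, if
-- v, w are non-adjacent, pick neighbours v', w'; a short case analysis on
-- the adjacencies among v, v', w, w' produces an unlinked pair of distinct
-- edges (either two edges at a common vertex whose other ends are
-- non-adjacent, or two edges with no adjacency between their endpoints).
module Submission where

open import Defs hiding (sym)
open import Data.Bool using (Bool; true; false; T; if_then_else_)
open import Data.Bool.Properties using (T-∧; T-≡; T-irrelevant)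
open import Data.Empty using (⊥-elim)
open import Data.Fin using (Fin; zero; suc; toℕ; punchOut; _≟_)
open import Data.Fin.Properties using (+↔⊎; 0↔⊥; 1↔⊤; punchOut-injective; pigeonhole; <⇒≢; <-cmp)
open import Data.List using (map; allFin)
open import Data.List.Properties using (map-tabulate)
open import Data.Nat using (ℕ; zero; suc; _+_; _<_)
open import Data.Nat.ListAction using (sum)
open import Data.Nat.Properties using (<ᵇ⇒<; <⇒<ᵇ; <-asym; n<1+n)
open import Data.Product using (Σ; ∃; ∃₂; _×_; _,_; proj₁; proj₂)
open import Data.Product.Algebra using (Σ-assoc-alt)
open import Data.Sum using (_⊎_; inj₁; inj₂; swap)
open import Data.Sum.Function.Propositional using (_⊎-↔_)
open import Data.Unit using (tt)
open import Function using (_∘_; id)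
open import Function.Bundles using (_↔_; _⇔_; mk⇔; mk↔ₛ′; Inverse; Injection; Equivalence)
open import Function.Properties.Inverse using (↔-trans; ↔-sym; ↔⇒↣)
open import Relation.Binary.Definitions using (tri<; tri≈; tri>)
open import Relation.Binary.PropositionalEquality
open import Relation.Nullary using (¬_; yes; no)

open Inverse using (to; from)

sum-allFin-suc : ∀ {n} (k : Fin (suc n) → ℕ) →
  sum (map k (allFin (suc n))) ≡ k zero + sum (map (k ∘ suc) (allFin n))
sum-allFin-suc k = cong (λ xs → k zero + sum xs)
  (trans (map-tabulate suc k) (sym (map-tabulate id (k ∘ suc))))

Σ-Fin-suc : ∀ {n} (P : Fin (suc n) → Set) → Σ (Fin (suc n)) P ↔ (P zero ⊎ Σ (Fin n) (P ∘ suc))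
Σ-Fin-suc P = mk↔ₛ′ split unsplit split∘unsplit unsplit∘split
  where
  split : Σ (Fin _) P → P zero ⊎ Σ (Fin _) (P ∘ suc)
  split (zero , x) = inj₁ x
  split (suc i , x) = inj₂ (i , x)
  unsplit : P zero ⊎ Σ (Fin _) (P ∘ suc) → Σ (Fin _) P
  unsplit (inj₁ x) = zero , x
  unsplit (inj₂ (i , x)) = suc i , x
  split∘unsplit : ∀ s → split (unsplit s) ≡ s
  split∘unsplit (inj₁ _) = refl
  split∘unsplit (inj₂ _) = refl
  unsplit∘split : ∀ p → unsplit (split p) ≡ p
  unsplit∘split (zero , _) = refl
  unsplit∘split (suc _ , _) = refl

Σ-Fin↔ : ∀ n (P : Fin n → Set) (k : Fin n → ℕ) → (∀ i → P i ↔ Fin (k i)) →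
  Σ (Fin n) P ↔ Fin (sum (map k (allFin n)))
Σ-Fin↔ zero P k fibres = mk↔ₛ′ (λ ()) (λ ()) (λ ()) (λ ())
Σ-Fin↔ (suc n) P k fibres =
  subst (λ s → Σ (Fin (suc n)) P ↔ Fin s) (sym (sum-allFin-suc k))
    (↔-trans (Σ-Fin-suc P)
    (↔-trans (fibres zero ⊎-↔ Σ-Fin↔ n (P ∘ suc) (k ∘ suc) (fibres ∘ suc))
             (↔-sym +↔⊎)))

T↔Fin : (b : Bool) → T b ↔ Fin (if b then 1 else 0)
T↔Fin true = ↔-sym 1↔⊤
T↔Fin false = ↔-sym 0↔⊥

redirect : ∀ {p} (a b : Fin (suc p)) → a ≢ b → Fin (suc p) → Σ (Fin (suc p)) (b ≢_)
redirect a b a≢b i with i ≟ b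
... | yes _ = a , a≢b ∘ sym
... | no i≢b = i , i≢b ∘ sym

merge : ∀ {p} (a b : Fin (suc p)) → a ≢ b → Fin (suc p) → Fin p
merge a b a≢b i = punchOut (proj₂ (redirect a b a≢b i))

merge-collision : ∀ {p} (a b : Fin (suc p)) (a≢b : a ≢ b) {i j} →
  merge a b a≢b i ≡ merge a b a≢b j → i ≡ j ⊎ (i ≡ a × j ≡ b) ⊎ (i ≡ b × j ≡ a)
merge-collision a b a≢b {i} {j} eq
  with i ≟ b | j ≟ b | punchOut-injective (proj₂ (redirect a b a≢b i)) (proj₂ (redirect a b a≢b j)) eq
... | yes i≡b | yes j≡b | _ = inj₁ (trans i≡b (sym j≡b))
... | yes i≡b | no _ | a≡j = inj₂ (inj₂ (i≡b , sym a≡j))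
... | no _ | yes j≡b | i≡a = inj₂ (inj₁ (i≡a , j≡b))
... | no _ | no _ | i≡j = inj₁ i≡j

module _ {n : ℕ} (G : Graph n) where

  edge↔ : Edge G ↔ Fin (size G)
  edge↔ = ↔-trans Σ-assoc-alt
    (Σ-Fin↔ n _ _ (λ i → Σ-Fin↔ n _ _ (λ j → T↔Fin (isEdge G i j))))

  adj-sym : ∀ {a b} → T (adj G a b) → T (adj G b a)
  adj-sym {a} {b} = subst T (Graph.sym G a b)

  adj-distinct : ∀ {a b} → T (adj G a b) → a ≢ b
  adj-distinct {a} p refl = subst T (Graph.irrefl G a) p

  T-from : ∀ {b} → b ≡ true → T b
  T-from = Equivalence.from T-≡

  JoinsG : Edge G → Fin n → Fin n → Set
  JoinsG e a b = Joins {G = G} e a b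

  Linked : Edge G → Edge G → Set
  Linked e f = ∃ λ g → Consecutive {G = G} e g f

  same-pair : (e f : Edge G) → proj₁ e ≡ proj₁ f → e ≡ f
  same-pair (p , x) (.p , y) refl = cong (p ,_) (T-irrelevant x y)

  edge-lt : (e : Edge G) → toℕ (proj₁ (proj₁ e)) < toℕ (proj₂ (proj₁ e))
  edge-lt ((i , j) , p) = <ᵇ⇒< _ _ (proj₁ (Equivalence.to T-∧ p))

  edge-adj : (e : Edge G) → T (adj G (proj₁ (proj₁ e)) (proj₂ (proj₁ e)))
  edge-adj ((i , j) , p) = proj₂ (Equivalence.to T-∧ p)

  joins-self : (e : Edge G) → JoinsG e (proj₁ (proj₁ e)) (proj₂ (proj₁ e))
  joins-self e = inj₁ (refl , refl)

  joins-flip : ∀ e {a b} → JoinsG e a b → JoinsG e b a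
  joins-flip e = swap

  joins-adj : ∀ e {a b} → JoinsG e a b → T (adj G a b)
  joins-adj e (inj₁ (refl , refl)) = edge-adj e
  joins-adj e (inj₂ (refl , refl)) = adj-sym (edge-adj e)

  joins-distinct : ∀ e {a b} → JoinsG e a b → a ≢ b
  joins-distinct e = adj-distinct ∘ joins-adj e

  joins-unique : ∀ e {a b x y} → JoinsG e a b → JoinsG e x y → (x ≡ a × y ≡ b) ⊎ (x ≡ b × y ≡ a)
  joins-unique e (inj₁ (refl , refl)) (inj₁ (refl , refl)) = inj₁ (refl , refl)
  joins-unique e (inj₁ (refl , refl)) (inj₂ (refl , refl)) = inj₂ (refl , refl)
  joins-unique e (inj₂ (refl , refl)) (inj₁ (refl , refl)) = inj₂ (refl , refl)
  joins-unique e (inj₂ (refl , refl)) (inj₂ (refl , refl)) = inj₁ (refl , refl)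

  other-endpoint : ∀ e {a b w} → JoinsG e a w → JoinsG e b w → a ≡ b
  other-endpoint e ja jb with joins-unique e ja jb
  ... | inj₁ (b≡a , _) = sym b≡a
  ... | inj₂ (_ , w≡a) = ⊥-elim (joins-distinct e ja (sym w≡a))

  endpoint-cases : ∀ e {a a' x y} → JoinsG e a a' → JoinsG e x y → y ≡ a ⊎ y ≡ a'
  endpoint-cases e ja jx with joins-unique e ja jx
  ... | inj₁ (_ , y≡a') = inj₂ y≡a'
  ... | inj₂ (_ , y≡a) = inj₁ y≡a

  -- Conversely, the endpoints determine the edge (T is proof-irrelevant,
  -- and the canonical order i < j rules out the two crossed cases).
  edge-determined : ∀ e f {a b} → JoinsG e a b → JoinsG f a b → e ≡ f
  edge-determined e f (inj₁ (refl , refl)) (inj₁ (refl , refl)) = same-pair e f refl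
  edge-determined e f (inj₁ (refl , refl)) (inj₂ (refl , refl)) = ⊥-elim (<-asym (edge-lt e) (edge-lt f))
  edge-determined e f (inj₂ (refl , refl)) (inj₁ (refl , refl)) = ⊥-elim (<-asym (edge-lt e) (edge-lt f))
  edge-determined e f (inj₂ (refl , refl)) (inj₂ (refl , refl)) = same-pair e f refl

  edge-between : ∀ a b → T (adj G a b) → Σ (Edge G) (λ e → JoinsG e a b)
  edge-between a b p with <-cmp a b
  ... | tri< a<b _ _ = ((a , b) , Equivalence.from T-∧ (<⇒<ᵇ a<b , p)) , inj₁ (refl , refl)
  ... | tri≈ _ a≡b _ = ⊥-elim (adj-distinct p a≡b)
  ... | tri> _ _ b<a = ((b , a) , Equivalence.from T-∧ (<⇒<ᵇ b<a , adj-sym p)) , inj₂ (refl , refl)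

  consecutive-sym : ∀ e g f → Consecutive {G = G} e g f → Consecutive {G = G} f g e
  consecutive-sym e g f (x , y , z , u , je , jg , jf , x≢z , y≢u) =
    u , z , y , x , joins-flip f jf , joins-flip g jg , joins-flip e je , y≢u ∘ sym , x≢z ∘ sym

  consecutive-distinct : ∀ e g f → Consecutive {G = G} e g f → e ≢ f
  consecutive-distinct e g f (x , y , z , u , je , jg , jf , x≢z , y≢u) refl
    with joins-unique e je jf
  ... | inj₁ (z≡x , _) = x≢z (sym z≡x)
  ... | inj₂ (z≡y , _) = joins-distinct g jg (sym z≡y)

  linked-via : ∀ e f {x y z u} → JoinsG e x y → JoinsG f z u → x ≢ z → y ≢ u →
    T (adj G y z) → Linked e f
  linked-via e f je jf x≢z y≢u y~z with edge-between _ _ y~z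
  ... | g , jg = g , _ , _ , _ , _ , je , jg , jf , x≢z , y≢u

  AllLinked : Set
  AllLinked = ∀ e f → e ≢ f → Linked e f

  UnlinkedPair : Set
  UnlinkedPair = ∃₂ λ e f → e ≢ f × ¬ Linked e f

  numbering-injective : ∀ {m} (ι : Edge G ↔ Fin m) {e f} → to ι e ≡ to ι f → e ≡ f
  numbering-injective ι = Injection.injective (↔⇒↣ ι)

  numbering-colouring : ∀ {m} → Edge G ↔ Fin m → InjColorable G m
  numbering-colouring ι = to ι , λ e₁ e₂ e₃ cons same →
    consecutive-distinct e₁ e₂ e₃ cons (numbering-injective ι same)

  -- If all distinct edges are linked, they need pairwise distinct colours
  -- (pigeonhole), so χ'ᵢ(G) ≥ m.
  all-linked⇒no-fewer-colours : ∀ {m} → Edge G ↔ Fin m → AllLinked →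
    ∀ j → j < m → ¬ InjColorable G j
  all-linked⇒no-fewer-colours ι linked j j<m (c , ok) with pigeonhole j<m (c ∘ from ι)
  ... | a , b , a<b , same with linked (from ι a) (from ι b) (<⇒≢ a<b ∘ from-injective)
    where
    from-injective : ∀ {a b} → from ι a ≡ from ι b → a ≡ b
    from-injective = Injection.injective (↔⇒↣ (↔-sym ι))
  ...   | g , cons = ok (from ι a) g (from ι b) cons same

  -- If e ≢ f are unlinked, recolouring f with the colour of e in the
  -- numbering stays injective, so χ'ᵢ(G) < m.  (An edge exists, so m > 0.)
  unlinked⇒fewer-colours : ∀ {m} → Edge G ↔ Fin m → UnlinkedPair →
    ∃ λ j → j < m × InjColorable G j
  unlinked⇒fewer-colours {zero} ι (e , _) with to ι e
  ... | ()
  unlinked⇒fewer-colours {suc p} ι (e , f , e≢f , unlinked) = p , n<1+n p , c , ok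
    where
    inj : ∀ {x y} → to ι x ≡ to ι y → x ≡ y
    inj = numbering-injective ι
    c : Edge G → Fin p
    c = merge (to ι e) (to ι f) (e≢f ∘ inj) ∘ to ι
    ok : IsInjEdgeColoring G c
    ok e₁ e₂ e₃ cons same with merge-collision (to ι e) (to ι f) (e≢f ∘ inj) same
    ... | inj₁ same-number = consecutive-distinct e₁ e₂ e₃ cons (inj same-number)
    ... | inj₂ (inj₁ (≡e , ≡f)) =
      unlinked (subst₂ Linked (inj ≡e) (inj ≡f) (e₂ , cons))
    ... | inj₂ (inj₂ (≡f , ≡e)) =
      unlinked (subst₂ Linked (inj ≡e) (inj ≡f) (e₂ , consecutive-sym e₁ e₂ e₃ cons))

  index-is-size⇒no-unlinked-pair : InjChromIndexIs G (size G) → ¬ UnlinkedPair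
  index-is-size⇒no-unlinked-pair (_ , minimal) pair with unlinked⇒fewer-colours edge↔ pair
  ... | j , j<m , colouring = minimal j j<m colouring

  all-linked⇒index-is-size : AllLinked → InjChromIndexIs G (size G)
  all-linked⇒index-is-size linked =
    numbering-colouring edge↔ , all-linked⇒no-fewer-colours edge↔ linked

  -- In a complete graph every two distinct edges are linked: if they share
  -- an endpoint, the edge between their other ends links them; otherwise
  -- any edge between an endpoint of each does.
  complete⇒all-linked : Complete G → AllLinked
  complete⇒all-linked complete e f e≢f = go (joins-self e) (joins-self f)
    where
    apart : ∀ {a b w} → JoinsG e a w → JoinsG f b w → a ≢ b
    apart ja jb refl = e≢f (edge-determined e f ja jb)
    shared : ∀ {a b w} → JoinsG e a w → JoinsG f b w → Linked e f
    shared ja jb = linked-via e f (joins-flip e ja) jb (joins-distinct f jb ∘ sym)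
      (joins-distinct e ja) (complete _ _ (apart ja jb))
    go : ∀ {x y z u} → JoinsG e x y → JoinsG f z u → Linked e f
    go {x} {y} {z} {u} je jf with y ≟ u | x ≟ z | y ≟ z
    ... | yes refl | _ | _ = shared je jf
    ... | no _ | yes refl | _ = shared (joins-flip e je) (joins-flip f jf)
    ... | no _ | no _ | yes refl = shared je (joins-flip f jf)
    ... | no y≢u | no x≢z | no y≢z = linked-via e f je jf x≢z y≢u (complete y z y≢z)

  -- Two edges aw, bw at a common vertex w with a ≁ b are unlinked: a middle
  -- edge would have to be ab, or one of the two edges themselves.
  shared-endpoint-unlinked : ∀ e f {a b w} → JoinsG e a w → JoinsG f b w →
    adj G a b ≡ false → ¬ Linked e f
  shared-endpoint-unlinked e f ja jb a≁b (g , x , y , z , u , je , jg , jf , x≢z , y≢u)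
    with joins-unique e ja je | joins-unique f jb jf
  ... | inj₁ (refl , refl) | inj₁ (refl , refl) = y≢u refl
  ... | inj₁ (refl , refl) | inj₂ (refl , refl) = joins-distinct g jg refl
  ... | inj₂ (refl , refl) | inj₁ (refl , refl) = subst T a≁b (joins-adj g jg)
  ... | inj₂ (refl , refl) | inj₂ (refl , refl) = x≢z refl

  NoEdgeBetween : Fin n → Fin n → Fin n → Fin n → Set
  NoEdgeBetween a a' b b' = ∀ {y z} → y ≡ a ⊎ y ≡ a' → z ≡ b ⊎ z ≡ b' → adj G y z ≡ false

  -- Edges aa', bb' with no edge between their endpoints are unlinked, since
  -- the middle edge of a consecutive triple joins such endpoints.
  far-apart-unlinked : ∀ e f {a a' b b'} → JoinsG e a a' → JoinsG f b b' →
    NoEdgeBetween a a' b b' → ¬ Linked e f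
  far-apart-unlinked e f ja jb far (g , x , y , z , u , je , jg , jf , _) =
    subst T (far (endpoint-cases e ja je) (endpoint-cases f jb (joins-flip f jf)))
      (joins-adj g jg)

  common-neighbour⇒unlinked-pair : ∀ {a b w} → a ≢ b → adj G a b ≡ false →
    T (adj G a w) → T (adj G b w) → UnlinkedPair
  common-neighbour⇒unlinked-pair a≢b a≁b a~w b~w
    with edge-between _ _ a~w | edge-between _ _ b~w
  ... | e , ja | f , jb =
    e , f , (λ { refl → a≢b (other-endpoint e ja jb) }) , shared-endpoint-unlinked e f ja jb a≁b

  far-apart⇒unlinked-pair : ∀ {a a' b b'} → T (adj G a a') → T (adj G b b') →
    NoEdgeBetween a a' b b' → UnlinkedPair
  far-apart⇒unlinked-pair a~a' b~b' far
    with edge-between _ _ a~a' | edge-between _ _ b~b'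
  ... | e , ja | f , jb = e , f , distinct , far-apart-unlinked e f ja jb far
    where
    distinct : e ≢ f
    distinct refl with joins-unique e ja jb
    ... | inj₁ (refl , refl) = subst T (far (inj₁ refl) (inj₂ refl)) a~a'
    ... | inj₂ (refl , refl) = subst T (far (inj₁ refl) (inj₁ refl)) a~a'

  -- A non-edge vw in a graph without isolated vertices yields an unlinked
  -- pair: with neighbours v', w', either some adjacency among v, v', w, w'
  -- gives a common neighbour of a non-adjacent pair, or vv' and ww' are far apart.
  non-edge⇒unlinked-pair : NoIsolatedVertices G → ∀ v w → v ≢ w → adj G v w ≡ false →
    UnlinkedPair
  non-edge⇒unlinked-pair no-isolated v w v≢w v≁w
    with no-isolated v | no-isolated w
  ... | v' , v~v' | w' , w~w'
    with adj G v w' in vw' | adj G w v' in wv' | adj G v' w' in v'w'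
  ... | true | _ | _ = common-neighbour⇒unlinked-pair v≢w v≁w (T-from vw') w~w'
  ... | false | true | _ = common-neighbour⇒unlinked-pair v≢w v≁w v~v' (T-from wv')
  ... | false | false | true =
    common-neighbour⇒unlinked-pair v≢w' vw' v~v' (adj-sym (T-from v'w'))
    where
    v≢w' : v ≢ w'
    v≢w' refl = subst T (trans (Graph.sym G w v) v≁w) w~w'
  ... | false | false | false = far-apart⇒unlinked-pair v~v' w~w' far
    where
    far : NoEdgeBetween v v' w w'
    far (inj₁ refl) (inj₁ refl) = v≁w
    far (inj₁ refl) (inj₂ refl) = vw'
    far (inj₂ refl) (inj₁ refl) = trans (Graph.sym G v' w) wv'
    far (inj₂ refl) (inj₂ refl) = v'w'

proposition4 : ∀ {n : ℕ} (G : Graph n) → NoIsolatedVertices G →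
    InjChromIndexIs G (size G) ⇔ Complete G
proposition4 G no-isolated = mk⇔ index-is-size⇒complete
  (all-linked⇒index-is-size G ∘ complete⇒all-linked G)
  where
  index-is-size⇒complete : InjChromIndexIs G (size G) → Complete G
  index-is-size⇒complete index v w v≢w with adj G v w in adj-vw
  ... | true = tt
  ... | false = ⊥-elim (index-is-size⇒no-unlinked-pair G index
                  (non-edge⇒unlinked-pair G no-isolated v w v≢w adj-vw))
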